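{- Let $\bar x=\bigsqcup_{i\in I}\bar x_i$ be a partition of the variables $\bar x=\{x_1,\dots,x_n\}$, let $\mathbb{F}$ be a field with $\mathrm{char}(\mathbb{F})=0$ or $\mathrm{char}(\mathbb{F})=p>|I|$, and let $\beta\in\mathbb{F}\setminus\{0,1,\dots,|I|\}$. For each $i\in I$ let $\psi_i\in\mathbb{F}[\bar x_i]$ be multilinear, of full degree ($\deg\psi_i=|\bar x_i|$), and Boolean-valued on $\{0,1\}^{\bar x_i}$. If $f\in\mathbb{F}[\bar x]$ is multilinear and $f(\bar x)\big(\sum_{i\in I}\psi_i-\beta\big)=1\pmod{\bar x^2-\bar x}$, then $\deg f=n$.
   Context: "mod $\bar x^2-\bar x$" means modulo the ideal generated by $x_i^2-x_i$, $i\in[n]$. -}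

module Defs where

open import Level using (_⊔_)
open import Algebra.Bundles using (CommutativeRing)
open import Data.Nat as ℕ using (ℕ; zero; suc; _<_; _≤_)
open import Data.Fin as Fin using (Fin)
open import Data.Bool as Bool using (Bool; true; false; if_then_else_)
open import Data.Vec using (Vec; []; _∷_; tabulate)
open import Data.Vec.Properties using (≡-dec)
open import Data.List as List using (List; []; _∷_; _++_; map; foldr)
open import Data.Fin.Subset using (Subset; _∪_; ⊥; ∣_∣; _⊆_; inside; outside)
open import Data.Fin.Subset.Properties using (_⊆?_)
open import Data.Product using (Σ; ∃; _×_; _,_)
open import Data.Sum using (_⊎_)
open import Relation.Nullary using (¬_; does)
open import Relation.Binary.PropositionalEquality using (_≡_)

allSubsets : (n : ℕ) → List (Subset n)
allSubsets zero    = [] ∷ []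
allSubsets (suc n) = map (outside ∷_) (allSubsets n) ++ map (inside ∷_) (allSubsets n)

_==ˢ_ : ∀ {n} → Subset n → Subset n → Bool
S ==ˢ T = does (≡-dec Bool._≟_ S T)

block : ∀ {n m} → (Fin n → Fin m) → Fin m → Subset n
block part i = tabulate (λ j → does (part j Fin.≟ i))

record IsField {c ℓ} (F : CommutativeRing c ℓ) : Set (c ⊔ ℓ) where
  open CommutativeRing F
  field
    1≉0     : ¬ (1# ≈ 0#)
    inverse : ∀ x → ¬ (x ≈ 0#) → ∃ λ y → x * y ≈ 1#

module Poly {c ℓ} (F : CommutativeRing c ℓ) where
  open CommutativeRing F

  natF : ℕ → Carrier
  natF zero    = 0#
  natF (suc k) = 1# + natF k

  Char0 : Set ℓ
  Char0 = ∀ k → 0 < k → ¬ (natF k ≈ 0#)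

  CharIs : ℕ → Set ℓ
  CharIs p = 0 < p × natF p ≈ 0# × (∀ k → 0 < k → k < p → ¬ (natF k ≈ 0#))

  Σˡ : ∀ {A : Set} → List A → (A → Carrier) → Carrier
  Σˡ xs f = foldr (λ x acc → f x + acc) 0# xs

  ΣS : ∀ n → (Subset n → Carrier) → Carrier
  ΣS n f = Σˡ (allSubsets n) f

  ΣFin : ∀ m → (Fin m → Carrier) → Carrier
  ΣFin m f = Σˡ (List.allFin m) f

  -- A multilinear polynomial in x₁..xₙ: coefficient of the monomial ∏_{j∈S} x_j.
  -- (Multilinear polynomials are canonical representatives of F[x̄]/(x̄²-x̄).)
  ML : ℕ → Set c
  ML n = Subset n → Carrier

  -- product in F[x̄]/(x̄²-x̄), i.e. product followed by multilinearisation x_j² ↦ x_j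
  _⊛_ : ∀ {n} → ML n → ML n → ML n
  _⊛_ {n} f g S = ΣS n (λ A → ΣS n (λ B →
                    if (A ∪ B) ==ˢ S then f A * g B else 0#))

  _⊕_ : ∀ {n} → ML n → ML n → ML n
  (f ⊕ g) S = f S + g S

  const : ∀ {n} → Carrier → ML n
  const a S = if S ==ˢ ⊥ then a else 0#

  sumML : ∀ {n} m → (Fin m → ML n) → ML n
  sumML m ψ S = ΣFin m (λ i → ψ i S)

  _≈ᴾ_ : ∀ {n} → ML n → ML n → Set ℓ
  f ≈ᴾ g = ∀ S → f S ≈ g S

  HasDegree : ∀ {n} → ML n → ℕ → Set ℓ
  HasDegree {n} f d =
    (∃ λ S → ∣ S ∣ ≡ d × ¬ (f S ≈ 0#)) × (∀ S → ¬ (f S ≈ 0#) → ∣ S ∣ ≤ d)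

  InVars : ∀ {n} → Subset n → ML n → Set ℓ
  InVars {n} B f = ∀ S → ¬ (S ⊆ B) → f S ≈ 0#

  -- evaluation at a 0/1 point a (a = set of coordinates equal to 1)
  eval : ∀ {n} → ML n → Subset n → Carrier
  eval {n} f a = ΣS n (λ S → if does (S ⊆? a) then f S else 0#)

  BooleanOn : ∀ {n} → Subset n → ML n → Set ℓ
  BooleanOn B f = ∀ a → a ⊆ B → (eval f a ≈ 0#) ⊎ (eval f a ≈ 1#)

-- Write f_B for the coefficient of the monomial x_B. For f ∈ F[x̄_B], inclusion–exclusion gives
-- f_B = Σ_{a ⊆ B} (-1)^|B ∖ a| f(a). On the cube every ψ_i is 0/1-valued, so f(a) = 1/(k(a) − β), where
-- k(a) counts the blocks i with ψ_i(a) = 1; β ∉ {0,…,m} keeps these denominators invertible. Expanding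
-- 1/(k − β) in the Lagrange basis of the Boolean values ψ_i(a), the alternating sum over the whole cube
-- factors over the blocks: f_[n] = ∏_i (ψ_i)_{x̄_i} · (Δ^m 1/(x − β))(0). The leading coefficients of the
-- ψ_i are nonzero by full degree, and (Δ^m 1/(x − β))(0) = (−1)^m m! / ∏_{j ≤ m} (j − β) is nonzero since
-- char F > m.

module Submission where

open import Defs
open import Algebra.Bundles using (CommutativeRing)
open import Data.Nat using (ℕ; _<_; _≤_)
open import Data.Fin using (Fin)
open import Data.Fin.Subset using (∣_∣)
open import Data.Product using (∃; _×_)
open import Data.Sum using (_⊎_)
open import Function.Definitions using (Surjective)
open import Relation.Binary.PropositionalEquality using (_≡_)
open import Relation.Nullary using (¬_)

import Algebra.Properties.CommutativeSemigroup
import Algebra.Properties.Group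
import Algebra.Properties.Ring
import Algebra.Solver.Ring.NaturalCoefficients.Default
open import Data.Bool using (Bool; true; false; if_then_else_; _∧_)
open import Data.Bool.Properties using (∧-zeroʳ)
open import Data.Empty using (⊥-elim)
open import Data.Fin using (zero; suc; _≟_)
open import Data.Fin.Subset using (Subset; inside; outside; _⊆_; _∩_; _∪_; ⊤) renaming (⊥ to ∅)
open import Data.Fin.Subset.Properties
  using (_⊆?_; drop-∷-⊆; p∩q⊆q; ∣⊤∣≡n; ∣p∣≤n; ⊆⊤; p⊆q⇒∣p∣≤∣q∣)
open import Data.List using (List; []; _∷_; _++_)
import Data.List as List
open import Data.Nat using (zero; suc; z≤n; s≤s; _≤?_)
import Data.Nat as ℕ
import Data.Nat.Properties as ℕₚ
open import Data.Product using (_,_; proj₁; proj₂)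
open import Data.Sum using (inj₁; inj₂)
open import Data.Vec using (_∷_; []; lookup; tabulate; here)
open import Data.Vec.Properties using (lookup∘tabulate)
open import Relation.Nullary using (does; yes; no)
open import Relation.Nullary.Decidable using (dec-true)
import Relation.Binary.PropositionalEquality as ≡

_⊆ᵇ_ : ∀ {n} → Subset n → Subset n → Bool
S ⊆ᵇ a = does (S ⊆? a)

∪-⊆ᵇ : ∀ {n} (A B a : Subset n) → (A ∪ B) ⊆ᵇ a ≡ (A ⊆ᵇ a ∧ B ⊆ᵇ a)
∪-⊆ᵇ []            []            []           = ≡.refl
∪-⊆ᵇ (outside ∷ A) (outside ∷ B) (_ ∷ a)      = ∪-⊆ᵇ A B a
∪-⊆ᵇ (outside ∷ A) (inside ∷ B)  (inside ∷ a) = ∪-⊆ᵇ A B a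
∪-⊆ᵇ (outside ∷ A) (inside ∷ B)  (outside ∷ a) = ≡.sym (∧-zeroʳ (A ⊆ᵇ a))
∪-⊆ᵇ (inside ∷ A)  (_ ∷ B)       (outside ∷ a) = ≡.refl
∪-⊆ᵇ (inside ∷ A)  (outside ∷ B) (inside ∷ a) = ∪-⊆ᵇ A B a
∪-⊆ᵇ (inside ∷ A)  (inside ∷ B)  (inside ∷ a) = ∪-⊆ᵇ A B a

⊆ᵇ-∩ : ∀ {n} (S a B : Subset n) → S ⊆ᵇ (a ∩ B) ≡ (S ⊆ᵇ a ∧ S ⊆ᵇ B)
⊆ᵇ-∩ []            []           []            = ≡.refl
⊆ᵇ-∩ (outside ∷ S) (_ ∷ a)      (_ ∷ B)       = ⊆ᵇ-∩ S a B
⊆ᵇ-∩ (inside ∷ S)  (inside ∷ a) (inside ∷ B)  = ⊆ᵇ-∩ S a B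
⊆ᵇ-∩ (inside ∷ S)  (inside ∷ a) (outside ∷ B) = ≡.sym (∧-zeroʳ (S ⊆ᵇ a))
⊆ᵇ-∩ (inside ∷ S)  (outside ∷ a) (_ ∷ B)      = ≡.refl

⊆ᵇ≡false⇒⊈ : ∀ {n} {S B : Subset n} → S ⊆ᵇ B ≡ false → ¬ (S ⊆ B)
⊆ᵇ≡false⇒⊈ {S = S} {B} eq S⊆B with S ⊆? B
... | no S⊈B = S⊈B S⊆B

∅-⊆ᵇ : ∀ {n} (a : Subset n) → ∅ ⊆ᵇ a ≡ true
∅-⊆ᵇ []      = ≡.refl
∅-⊆ᵇ (_ ∷ a) = ∅-⊆ᵇ a

==ˢ-sym : ∀ {n} (X S : Subset n) → (X ==ˢ S) ≡ (S ==ˢ X)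
==ˢ-sym []            []            = ≡.refl
==ˢ-sym (inside ∷ X)  (inside ∷ S)  = ==ˢ-sym X S
==ˢ-sym (inside ∷ X)  (outside ∷ S) = ≡.refl
==ˢ-sym (outside ∷ X) (inside ∷ S)  = ≡.refl
==ˢ-sym (outside ∷ X) (outside ∷ S) = ==ˢ-sym X S

⊆∧∣≡∣⇒≡ : ∀ {n} {S B : Subset n} → S ⊆ B → ∣ S ∣ ≡ ∣ B ∣ → S ≡ B
⊆∧∣≡∣⇒≡ {S = []}          {[]}          _   _ = ≡.refl
⊆∧∣≡∣⇒≡ {S = inside ∷ S}  {inside ∷ B}  S⊆B e =
  ≡.cong (inside ∷_) (⊆∧∣≡∣⇒≡ (drop-∷-⊆ S⊆B) (ℕₚ.suc-injective e))
⊆∧∣≡∣⇒≡ {S = inside ∷ S}  {outside ∷ B} S⊆B e with S⊆B here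
... | ()
⊆∧∣≡∣⇒≡ {S = outside ∷ S} {inside ∷ B}  S⊆B e =
  ⊥-elim (ℕₚ.n≮n ∣ B ∣ (≡.subst (_≤ ∣ B ∣) e (p⊆q⇒∣p∣≤∣q∣ (drop-∷-⊆ S⊆B))))
⊆∧∣≡∣⇒≡ {S = outside ∷ S} {outside ∷ B} S⊆B e =
  ≡.cong (outside ∷_) (⊆∧∣≡∣⇒≡ (drop-∷-⊆ S⊆B) e)

block-member : ∀ {n m} {part : Fin n → Fin m} → Surjective _≡_ _≡_ part →
               ∀ i → ∃ λ j → lookup (block part i) j ≡ inside
block-member {part = part} surj i with surj i
... | j , part≡i = j , ≡.trans (lookup∘tabulate _ j) (dec-true (part j ≟ i) (part≡i ≡.refl))

module Multilinear {c ℓ} (F : CommutativeRing c ℓ) where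
  open CommutativeRing F hiding (zero)
  open Poly F
  open Algebra.Properties.Ring ring using (-‿involutive; -‿+-comm; -0#≈0#; -‿distribˡ-*; -‿distribʳ-*)
  open Algebra.Properties.CommutativeSemigroup +-commutativeSemigroup
    using () renaming (interchange to +-interchange)
  open Algebra.Solver.Ring.NaturalCoefficients.Default commutativeSemiring using (solve; _:=_; _:+_; _:*_)
  open import Relation.Binary.Reasoning.Setoid setoid

  Σˡ-cong : ∀ {A : Set} (xs : List A) {g h : A → Carrier} → (∀ x → g x ≈ h x) → Σˡ xs g ≈ Σˡ xs h
  Σˡ-cong []       g≈h = refl
  Σˡ-cong (x ∷ xs) g≈h = +-cong (g≈h x) (Σˡ-cong xs g≈h)

  Σˡ-0 : ∀ {A : Set} (xs : List A) → Σˡ xs (λ _ → 0#) ≈ 0#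
  Σˡ-0 []       = refl
  Σˡ-0 (x ∷ xs) = trans (+-identityˡ _) (Σˡ-0 xs)

  Σˡ-+ : ∀ {A : Set} (xs : List A) (g h : A → Carrier) → Σˡ xs (λ x → g x + h x) ≈ Σˡ xs g + Σˡ xs h
  Σˡ-+ []       g h = sym (+-identityˡ 0#)
  Σˡ-+ (x ∷ xs) g h = trans (+-congˡ (Σˡ-+ xs g h)) (+-interchange (g x) (h x) _ _)

  Σˡ-*ˡ : ∀ {A : Set} (xs : List A) (a : Carrier) (h : A → Carrier) → Σˡ xs (λ x → a * h x) ≈ a * Σˡ xs h
  Σˡ-*ˡ []       a h = sym (zeroʳ a)
  Σˡ-*ˡ (x ∷ xs) a h = trans (+-congˡ (Σˡ-*ˡ xs a h)) (sym (distribˡ a (h x) (Σˡ xs h)))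

  Σˡ-*ʳ : ∀ {A : Set} (xs : List A) (a : Carrier) (h : A → Carrier) → Σˡ xs (λ x → h x * a) ≈ Σˡ xs h * a
  Σˡ-*ʳ xs a h = trans (Σˡ-cong xs (λ x → *-comm (h x) a)) (trans (Σˡ-*ˡ xs a h) (*-comm a _))

  Σˡ-swap : ∀ {A B : Set} (xs : List A) (ys : List B) (h : A → B → Carrier) →
            Σˡ xs (λ x → Σˡ ys (h x)) ≈ Σˡ ys (λ y → Σˡ xs (λ x → h x y))
  Σˡ-swap []       ys h = sym (Σˡ-0 ys)
  Σˡ-swap (x ∷ xs) ys h =
    trans (+-congˡ (Σˡ-swap xs ys h)) (sym (Σˡ-+ ys (h x) (λ y → Σˡ xs (λ x' → h x' y))))

  Σˡ-++ : ∀ {A : Set} (xs ys : List A) (h : A → Carrier) → Σˡ (xs ++ ys) h ≈ Σˡ xs h + Σˡ ys h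
  Σˡ-++ []       ys h = sym (+-identityˡ _)
  Σˡ-++ (x ∷ xs) ys h = trans (+-congˡ (Σˡ-++ xs ys h)) (sym (+-assoc _ _ _))

  Σˡ-map : ∀ {A B : Set} (g : A → B) (xs : List A) (h : B → Carrier) →
           Σˡ (List.map g xs) h ≡ Σˡ xs (λ x → h (g x))
  Σˡ-map g []       h = ≡.refl
  Σˡ-map g (x ∷ xs) h = ≡.cong (h (g x) +_) (Σˡ-map g xs h)

  ΣS-suc : ∀ n (h : Subset (suc n) → Carrier) →
           ΣS (suc n) h ≈ ΣS n (λ S → h (outside ∷ S)) + ΣS n (λ S → h (inside ∷ S))
  ΣS-suc n h = trans (Σˡ-++ (List.map (outside ∷_) (allSubsets n)) _ h)
                     (+-cong (reflexive (Σˡ-map (outside ∷_) (allSubsets n) h))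
                             (reflexive (Σˡ-map (inside ∷_) (allSubsets n) h)))

  when : Bool → Carrier → Carrier
  when b x = if b then x else 0#

  when-cong : ∀ b {x y} → x ≈ y → when b x ≈ when b y
  when-cong true  x≈y = x≈y
  when-cong false x≈y = refl

  when-Σˡ : ∀ {A : Set} b (xs : List A) h → when b (Σˡ xs h) ≈ Σˡ xs (λ x → when b (h x))
  when-Σˡ true  xs h = refl
  when-Σˡ false xs h = sym (Σˡ-0 xs)

  when-+ : ∀ b x y → when b (x + y) ≈ when b x + when b y
  when-+ true  x y = refl
  when-+ false x y = sym (+-identityˡ 0#)

  when-comm : ∀ b d x → when b (when d x) ≡ when d (when b x)
  when-comm true  true  x = ≡.refl
  when-comm true  false x = ≡.refl
  when-comm false true  x = ≡.refl
  when-comm false false x = ≡.refl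

  when-∧-* : ∀ b d x y → when (b ∧ d) (x * y) ≈ when b x * when d y
  when-∧-* true  true  x y = refl
  when-∧-* true  false x y = sym (zeroʳ x)
  when-∧-* false d     x y = sym (zeroˡ _)

  when-∧-redundant : ∀ b d x → (d ≡ false → x ≈ 0#) → when b x ≈ when (b ∧ d) x
  when-∧-redundant true  true  x _   = refl
  when-∧-redundant true  false x d⇒0 = d⇒0 ≡.refl
  when-∧-redundant false d     x _   = refl

  ΣS-δ : ∀ n (X : Subset n) (h : Subset n → Carrier) → ΣS n (λ S → when (X ==ˢ S) (h S)) ≈ h X
  ΣS-δ zero    []            h = +-identityʳ (h [])
  ΣS-δ (suc n) (inside ∷ X)  h = trans (ΣS-suc n _)
    (trans (+-cong (Σˡ-0 (allSubsets n)) (ΣS-δ n X (λ S → h (inside ∷ S)))) (+-identityˡ _))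
  ΣS-δ (suc n) (outside ∷ X) h = trans (ΣS-suc n _)
    (trans (+-cong (ΣS-δ n X (λ S → h (outside ∷ S))) (Σˡ-0 (allSubsets n))) (+-identityʳ _))

  eval-cong : ∀ {n} {f g : ML n} → f ≈ᴾ g → ∀ a → eval f a ≈ eval g a
  eval-cong {n} f≈g a = Σˡ-cong (allSubsets n) (λ S → when-cong (S ⊆ᵇ a) (f≈g S))

  eval-⊕ : ∀ {n} (f g : ML n) a → eval (f ⊕ g) a ≈ eval f a + eval g a
  eval-⊕ {n} f g a =
    trans (Σˡ-cong (allSubsets n) (λ S → when-+ (S ⊆ᵇ a) (f S) (g S))) (Σˡ-+ (allSubsets n) _ _)

  eval-sumML : ∀ {n} m (ψ : Fin m → ML n) a → eval (sumML m ψ) a ≈ ΣFin m (λ i → eval (ψ i) a)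
  eval-sumML {n} m ψ a = trans (Σˡ-cong (allSubsets n) (λ S → when-Σˡ (S ⊆ᵇ a) (List.allFin m) _))
                               (Σˡ-swap (allSubsets n) (List.allFin m) _)

  eval-const : ∀ {n} (k : Carrier) a → eval {n} (const k) a ≈ k
  eval-const {n} k a = begin
    ΣS n (λ S → when (S ⊆ᵇ a) (when (S ==ˢ ∅) k))
      ≈⟨ Σˡ-cong (allSubsets n) (λ S → reflexive (≡.trans (when-comm (S ⊆ᵇ a) (S ==ˢ ∅) k)
                                                         (≡.cong (λ b → when b (when (S ⊆ᵇ a) k)) (==ˢ-sym S ∅)))) ⟩
    ΣS n (λ S → when (∅ ==ˢ S) (when (S ⊆ᵇ a) k))
      ≈⟨ ΣS-δ n ∅ (λ S → when (S ⊆ᵇ a) k) ⟩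
    when (∅ ⊆ᵇ a) k
      ≡⟨ ≡.cong (λ b → when b k) (∅-⊆ᵇ a) ⟩
    k ∎

  eval-⊛ : ∀ {n} (f g : ML n) a → eval (f ⊛ g) a ≈ eval f a * eval g a
  eval-⊛ {n} f g a = begin
    Σˡ L (λ S → when (S ⊆ᵇ a) (Σˡ L (λ A → Σˡ L (λ B → when ((A ∪ B) ==ˢ S) (f A * g B)))))
      ≈⟨ Σˡ-cong L (λ S → trans (when-Σˡ (S ⊆ᵇ a) L _) (Σˡ-cong L (λ A → when-Σˡ (S ⊆ᵇ a) L _))) ⟩
    Σˡ L (λ S → Σˡ L (λ A → Σˡ L (λ B → when (S ⊆ᵇ a) (when ((A ∪ B) ==ˢ S) (f A * g B)))))
      ≈⟨ trans (Σˡ-swap L L _) (Σˡ-cong L (λ A → Σˡ-swap L L _)) ⟩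
    Σˡ L (λ A → Σˡ L (λ B → Σˡ L (λ S → when (S ⊆ᵇ a) (when ((A ∪ B) ==ˢ S) (f A * g B)))))
      ≈⟨ Σˡ-cong L (λ A → Σˡ-cong L (λ B → collapse A B)) ⟩
    Σˡ L (λ A → Σˡ L (λ B → when ((A ∪ B) ⊆ᵇ a) (f A * g B)))
      ≈⟨ Σˡ-cong L (λ A → Σˡ-cong L (λ B → split A B)) ⟩
    Σˡ L (λ A → Σˡ L (λ B → when (A ⊆ᵇ a) (f A) * when (B ⊆ᵇ a) (g B)))
      ≈⟨ trans (Σˡ-cong L (λ A → Σˡ-*ˡ L _ _)) (Σˡ-*ʳ L _ _) ⟩
    eval f a * eval g a ∎
    where
      L : List (Subset n)
      L = allSubsets n
      collapse : ∀ A B → ΣS n (λ S → when (S ⊆ᵇ a) (when ((A ∪ B) ==ˢ S) (f A * g B)))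
                         ≈ when ((A ∪ B) ⊆ᵇ a) (f A * g B)
      collapse A B = trans (Σˡ-cong L (λ S → reflexive (when-comm (S ⊆ᵇ a) ((A ∪ B) ==ˢ S) _)))
                           (ΣS-δ n (A ∪ B) (λ S → when (S ⊆ᵇ a) (f A * g B)))
      split : ∀ A B → when ((A ∪ B) ⊆ᵇ a) (f A * g B) ≈ when (A ⊆ᵇ a) (f A) * when (B ⊆ᵇ a) (g B)
      split A B = trans (reflexive (≡.cong (λ b → when b (f A * g B)) (∪-⊆ᵇ A B a)))
                        (when-∧-* (A ⊆ᵇ a) (B ⊆ᵇ a) (f A) (g B))

  eval-∩ : ∀ {n} {B : Subset n} {f : ML n} → InVars B f → ∀ a → eval f a ≈ eval f (a ∩ B)
  eval-∩ {n} {B} {f} f∈B a = Σˡ-cong (allSubsets n) (λ S →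
    trans (when-∧-redundant (S ⊆ᵇ a) (S ⊆ᵇ B) (f S) (λ S⊈B → f∈B S (⊆ᵇ≡false⇒⊈ S⊈B)))
          (reflexive (≡.cong (λ b → when b (f S)) (≡.sym (⊆ᵇ-∩ S a B)))))

  eval-outside∷ : ∀ {n} (f : ML (suc n)) a → eval f (outside ∷ a) ≈ eval (λ S → f (outside ∷ S)) a
  eval-outside∷ {n} f a = trans (ΣS-suc n _) (trans (+-congˡ (Σˡ-0 (allSubsets n))) (+-identityʳ _))

  eval-inside∷ : ∀ {n} (f : ML (suc n)) a →
                 eval f (inside ∷ a) ≈ eval (λ S → f (outside ∷ S)) a + eval (λ S → f (inside ∷ S)) a
  eval-inside∷ {n} f a = ΣS-suc n _

  -- alt B g = Σ_{a ⊆ B} (-1)^|B ∖ a| g a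
  alt : ∀ {n} → Subset n → (Subset n → Carrier) → Carrier
  alt []            g = g []
  alt (outside ∷ B) g = alt B (λ a → g (outside ∷ a))
  alt (inside ∷ B)  g = alt B (λ a → g (inside ∷ a)) - alt B (λ a → g (outside ∷ a))

  alt-cong : ∀ {n} (B : Subset n) {g h : Subset n → Carrier} → (∀ a → g a ≈ h a) → alt B g ≈ alt B h
  alt-cong []            g≈h = g≈h []
  alt-cong (outside ∷ B) g≈h = alt-cong B (λ a → g≈h (outside ∷ a))
  alt-cong (inside ∷ B)  g≈h =
    +-cong (alt-cong B (λ a → g≈h (inside ∷ a))) (-‿cong (alt-cong B (λ a → g≈h (outside ∷ a))))

  alt-0 : ∀ {n} (B : Subset n) → alt B (λ _ → 0#) ≈ 0#
  alt-0 []            = refl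
  alt-0 (outside ∷ B) = alt-0 B
  alt-0 (inside ∷ B)  = -‿inverseʳ _

  alt-+ : ∀ {n} (B : Subset n) (g h : Subset n → Carrier) → alt B (λ a → g a + h a) ≈ alt B g + alt B h
  alt-+ []            g h = refl
  alt-+ (outside ∷ B) g h = alt-+ B _ _
  alt-+ (inside ∷ B)  g h = begin
    alt B (λ a → g₁ a + h₁ a) - alt B (λ a → g₀ a + h₀ a)
      ≈⟨ +-cong (alt-+ B g₁ h₁) (trans (-‿cong (alt-+ B g₀ h₀)) (sym (-‿+-comm _ _))) ⟩
    (alt B g₁ + alt B h₁) + (- alt B g₀ + - alt B h₀)
      ≈⟨ +-interchange _ _ _ _ ⟩
    (alt B g₁ - alt B g₀) + (alt B h₁ - alt B h₀) ∎
    where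
      g₀ g₁ h₀ h₁ : Subset _ → Carrier
      g₀ a = g (outside ∷ a)
      g₁ a = g (inside ∷ a)
      h₀ a = h (outside ∷ a)
      h₁ a = h (inside ∷ a)

  alt-neg : ∀ {n} (B : Subset n) (g : Subset n → Carrier) → alt B (λ a → - g a) ≈ - alt B g
  alt-neg []            g = refl
  alt-neg (outside ∷ B) g = alt-neg B _
  alt-neg (inside ∷ B)  g = trans (+-cong (alt-neg B _) (-‿cong (alt-neg B _))) (-‿+-comm _ _)

  alt-- : ∀ {n} (B : Subset n) (g h : Subset n → Carrier) → alt B (λ a → g a - h a) ≈ alt B g - alt B h
  alt-- B g h = trans (alt-+ B g (λ a → - h a)) (+-congˡ (alt-neg B h))

  alt-*ˡ : ∀ {n} (B : Subset n) (k : Carrier) (g : Subset n → Carrier) → alt B (λ a → k * g a) ≈ k * alt B g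
  alt-*ˡ []            k g = refl
  alt-*ˡ (outside ∷ B) k g = alt-*ˡ B k _
  alt-*ˡ (inside ∷ B)  k g = trans (+-cong (alt-*ˡ B k _) (-‿cong (alt-*ˡ B k _)))
                                  (trans (+-congˡ (-‿distribʳ-* k _)) (sym (distribˡ k _ _)))

  alt-Σˡ : ∀ {n} {A : Set} (B : Subset n) (xs : List A) (h : A → Subset n → Carrier) →
           alt B (λ a → Σˡ xs (λ x → h x a)) ≈ Σˡ xs (λ x → alt B (h x))
  alt-Σˡ B []       h = alt-0 B
  alt-Σˡ B (x ∷ xs) h = trans (alt-+ B (h x) _) (+-congˡ (alt-Σˡ B xs h))

  alt-const : ∀ {n} (B : Subset n) {j : Fin n} → lookup B j ≡ inside → ∀ k → alt B (λ _ → k) ≈ 0#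
  alt-const (inside ∷ B)  _   k = -‿inverseʳ _
  alt-const (outside ∷ B) {suc j} j∈B k = alt-const B j∈B k

  coeff≈alt-eval : ∀ {n} (B : Subset n) (f : ML n) → InVars B f → f B ≈ alt B (eval f)
  coeff≈alt-eval []            f f∈B = sym (+-identityʳ (f []))
  coeff≈alt-eval (outside ∷ B) f f∈B =
    trans (coeff≈alt-eval B f₀ (λ S S⊈B → f∈B (outside ∷ S) (λ p → S⊈B (drop-∷-⊆ p))))
          (alt-cong B (λ a → sym (eval-outside∷ f a)))
    where f₀ : ML _
          f₀ S = f (outside ∷ S)
  coeff≈alt-eval (inside ∷ B)  f f∈B = begin
    f₁ B
      ≈⟨ coeff≈alt-eval B f₁ (λ S S⊈B → f∈B (inside ∷ S) (λ p → S⊈B (drop-∷-⊆ p))) ⟩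
    alt B (eval f₁)
      ≈⟨ sym (x+y-x≈y (alt B (eval f₀)) (alt B (eval f₁))) ⟩
    (alt B (eval f₀) + alt B (eval f₁)) - alt B (eval f₀)
      ≈⟨ +-cong (sym (alt-+ B _ _)) refl ⟩
    alt B (λ a → eval f₀ a + eval f₁ a) - alt B (eval f₀)
      ≈⟨ +-cong (alt-cong B (λ a → sym (eval-inside∷ f a)))
                (-‿cong (alt-cong B (λ a → sym (eval-outside∷ f a)))) ⟩
    alt (inside ∷ B) (eval f) ∎
    where
      f₀ f₁ : ML _
      f₀ S = f (outside ∷ S)
      f₁ S = f (inside ∷ S)
      x+y-x≈y : ∀ x y → (x + y) - x ≈ y
      x+y-x≈y x y = begin
        (x + y) - x   ≈⟨ solve 3 (λ x y x' → (x :+ y) :+ x' := y :+ (x :+ x')) refl x y (- x) ⟩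
        y + (x - x)   ≈⟨ +-congˡ (-‿inverseʳ x) ⟩
        y + 0#        ≈⟨ +-identityʳ y ⟩
        y ∎

  ΠFin : ∀ m → (Fin m → Carrier) → Carrier
  ΠFin zero    g = 1#
  ΠFin (suc m) g = g zero * ΠFin m (λ i → g (suc i))

  ΠFin-cong : ∀ m {u v : Fin m → Carrier} → (∀ i → u i ≈ v i) → ΠFin m u ≈ ΠFin m v
  ΠFin-cong zero    u≈v = refl
  ΠFin-cong (suc m) u≈v = *-cong (u≈v zero) (ΠFin-cong m (λ i → u≈v (suc i)))

  ΠFin-- : ∀ m (p : Fin m) (u v : Fin m → Carrier) → (∀ i → does (p ≟ i) ≡ false → u i ≈ v i) →
           ΠFin m u - ΠFin m v ≈ ΠFin m (λ i → if does (p ≟ i) then u i - v i else v i)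
  ΠFin-- (suc m) zero    u v u≈v = begin
    u zero * ΠFin m (λ i → u (suc i)) - v zero * ΠFin m (λ i → v (suc i))
      ≈⟨ +-cong (*-congˡ (ΠFin-cong m (λ i → u≈v (suc i) ≡.refl))) (-‿distribˡ-* _ _) ⟩
    u zero * ΠFin m (λ i → v (suc i)) + (- v zero) * ΠFin m (λ i → v (suc i))
      ≈⟨ sym (distribʳ _ _ _) ⟩
    (u zero - v zero) * ΠFin m (λ i → v (suc i)) ∎
  ΠFin-- (suc m) (suc p) u v u≈v = begin
    u zero * ΠFin m (λ i → u (suc i)) - v zero * ΠFin m (λ i → v (suc i))
      ≈⟨ +-cong (*-congʳ (u≈v zero ≡.refl)) (-‿distribʳ-* _ _) ⟩
    v zero * ΠFin m (λ i → u (suc i)) + v zero * - ΠFin m (λ i → v (suc i))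
      ≈⟨ sym (distribˡ _ _ _) ⟩
    v zero * (ΠFin m (λ i → u (suc i)) - ΠFin m (λ i → v (suc i)))
      ≈⟨ *-congˡ (ΠFin-- m p (λ i → u (suc i)) (λ i → v (suc i)) (λ i → u≈v (suc i))) ⟩
    v zero * ΠFin m (λ i → if does (p ≟ i) then u (suc i) - v (suc i) else v (suc i)) ∎

  BlockLocal : ∀ {n m} → (Fin n → Fin m) → (Fin m → Subset n → Carrier) → Set ℓ
  BlockLocal part g = ∀ i a b → a ∩ block part i ≡ b ∩ block part i → g i a ≈ g i b

  -- Coordinate 0 lies only in block (part zero), so peeling it off changes a single factor.
  alt-⊤-ΠFin : ∀ n m (part : Fin n → Fin m) (g : Fin m → Subset n → Carrier) → BlockLocal part g →
               alt ⊤ (λ a → ΠFin m (λ i → g i a)) ≈ ΠFin m (λ i → alt (block part i) (g i))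
  alt-⊤-ΠFin zero    m part g local = refl
  alt-⊤-ΠFin (suc n) m part g local = begin
    alt ⊤ (λ a → ΠFin m (λ i → g i (inside ∷ a))) - alt ⊤ (λ a → ΠFin m (λ i → g i (outside ∷ a)))
      ≈⟨ sym (alt-- (⊤ {n}) _ _) ⟩
    alt ⊤ (λ a → ΠFin m (λ i → g i (inside ∷ a)) - ΠFin m (λ i → g i (outside ∷ a)))
      ≈⟨ alt-cong (⊤ {n}) (λ a → ΠFin-- m (part zero) _ _
                                    (λ i 0∉i → local i _ _ (flip-outside-block a i 0∉i))) ⟩
    alt ⊤ (λ a → ΠFin m (λ i → g′ i a))
      ≈⟨ alt-⊤-ΠFin n m part′ g′ local′ ⟩
    ΠFin m (λ i → alt (block part′ i) (g′ i))
      ≈⟨ ΠFin-cong m (λ i → peel (does (part zero ≟ i)) (block part′ i) (g i)) ⟩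
    ΠFin m (λ i → alt (block part i) (g i)) ∎
    where
      part′ : Fin n → Fin m
      part′ j = part (suc j)
      g′ : Fin m → Subset n → Carrier
      g′ i a = if does (part zero ≟ i) then g i (inside ∷ a) - g i (outside ∷ a) else g i (outside ∷ a)
      flip-outside-block : ∀ a i → does (part zero ≟ i) ≡ false →
                           (inside ∷ a) ∩ block part i ≡ (outside ∷ a) ∩ block part i
      flip-outside-block a i 0∉i = ≡.cong (_∷ (a ∩ block part′ i)) (≡.cong (inside ∧_) 0∉i)
      local′ : BlockLocal part′ g′
      local′ i a b a≡b = step-cong (does (part zero ≟ i)) (local i _ _ (extend inside)) (local i _ _ (extend outside))
        where
          extend : ∀ x → (x ∷ a) ∩ block part i ≡ (x ∷ b) ∩ block part i
          extend x = ≡.cong ((x ∧ does (part zero ≟ i)) ∷_) a≡b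
          step-cong : ∀ d {x x′ y y′} → x ≈ x′ → y ≈ y′ →
                      (if d then x - y else y) ≈ (if d then x′ - y′ else y′)
          step-cong true  x≈x′ y≈y′ = +-cong x≈x′ (-‿cong y≈y′)
          step-cong false x≈x′ y≈y′ = y≈y′
      peel : ∀ d (B : Subset n) (h : Subset (suc n) → Carrier) →
             alt B (λ a → if d then h (inside ∷ a) - h (outside ∷ a) else h (outside ∷ a)) ≈ alt (d ∷ B) h
      peel true  B h = alt-- B _ _
      peel false B h = refl

  fromBool : Bool → Carrier
  fromBool true  = 1#
  fromBool false = 0#

  -- agree b x is the Lagrange basis polynomial of the point b ∈ {0,1}
  agree : Bool → Carrier → Carrier
  agree true  x = x
  agree false x = 1# - x

  agree-cong : ∀ b {x y} → x ≈ y → agree b x ≈ agree b y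
  agree-cong true  x≈y = x≈y
  agree-cong false x≈y = +-congˡ (-‿cong x≈y)

  ΠFin-agree : ∀ m (s t : Subset m) →
               ΠFin m (λ i → agree (lookup t i) (fromBool (lookup s i))) ≈ fromBool (s ==ˢ t)
  ΠFin-agree zero    []            []            = refl
  ΠFin-agree (suc m) (inside ∷ s)  (inside ∷ t)  = trans (*-identityˡ _) (ΠFin-agree m s t)
  ΠFin-agree (suc m) (outside ∷ s) (outside ∷ t) =
    trans (*-congʳ 1-0≈1) (trans (*-identityˡ _) (ΠFin-agree m s t))
    where
      1-0≈1 : 1# - 0# ≈ 1#
      1-0≈1 = trans (+-congˡ -0#≈0#) (+-identityʳ 1#)
  ΠFin-agree (suc m) (inside ∷ s)  (outside ∷ t) = trans (*-congʳ (-‿inverseʳ 1#)) (zeroˡ _)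
  ΠFin-agree (suc m) (outside ∷ s) (inside ∷ t)  = zeroˡ _

  *-fromBool : ∀ x b → x * fromBool b ≈ when b x
  *-fromBool x true  = *-identityʳ x
  *-fromBool x false = zeroʳ x

  ΣS-interpolate : ∀ m (s : Subset m) (e : Fin m → Carrier) → (∀ i → e i ≈ fromBool (lookup s i)) →
                   ∀ (h : Subset m → Carrier) →
                   ΣS m (λ t → h t * ΠFin m (λ i → agree (lookup t i) (e i))) ≈ h s
  ΣS-interpolate m s e e≈s h = begin
    ΣS m (λ t → h t * ΠFin m (λ i → agree (lookup t i) (e i)))
      ≈⟨ Σˡ-cong (allSubsets m) (λ t → *-congˡ (ΠFin-cong m (λ i → agree-cong (lookup t i) (e≈s i)))) ⟩
    ΣS m (λ t → h t * ΠFin m (λ i → agree (lookup t i) (fromBool (lookup s i))))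
      ≈⟨ Σˡ-cong (allSubsets m) (λ t → trans (*-congˡ (ΠFin-agree m s t)) (*-fromBool (h t) (s ==ˢ t))) ⟩
    ΣS m (λ t → when (s ==ˢ t) (h t))
      ≈⟨ ΣS-δ m s h ⟩
    h s ∎

  sign : Bool → Carrier → Carrier
  sign true  x = x
  sign false x = - x

  alt-agree : ∀ {n} b (B : Subset n) {j : Fin n} → lookup B j ≡ inside →
              ∀ (g : Subset n → Carrier) → alt B (λ a → agree b (g a)) ≈ sign b (alt B g)
  alt-agree true  B j∈B g = refl
  alt-agree false B j∈B g = trans (alt-- B (λ _ → 1#) g) (trans (+-congʳ (alt-const B j∈B 1#)) (+-identityˡ _))

  Δ : (ℕ → Carrier) → ℕ → Carrier
  Δ h x = h (suc x) - h x

  Δ^ : ℕ → (ℕ → Carrier) → ℕ → Carrier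
  Δ^ zero    h = h
  Δ^ (suc j) h = Δ^ j (Δ h)

  Δ^-Δ : ∀ j h x → Δ^ j (Δ h) x ≡ Δ (Δ^ j h) x
  Δ^-Δ zero    h x = ≡.refl
  Δ^-Δ (suc j) h x = Δ^-Δ j (Δ h) x

  ΣS-sign≈Δ^ : ∀ m (c : Fin m → Carrier) (h : ℕ → Carrier) →
               ΣS m (λ t → h ∣ t ∣ * ΠFin m (λ i → sign (lookup t i) (c i))) ≈ ΠFin m c * Δ^ m h 0
  ΣS-sign≈Δ^ zero    c h = trans (+-identityʳ _) (*-comm _ _)
  ΣS-sign≈Δ^ (suc m) c h = begin
    ΣS (suc m) (λ t → h ∣ t ∣ * ΠFin (suc m) (λ i → sign (lookup t i) (c i)))
      ≈⟨ trans (ΣS-suc m _) (sym (Σˡ-+ L _ _)) ⟩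
    ΣS m (λ t → h ∣ t ∣ * (- c zero * P t) + h (suc ∣ t ∣) * (c zero * P t))
      ≈⟨ Σˡ-cong L (λ t → collect (h ∣ t ∣) (h (suc ∣ t ∣)) (c zero) (P t)) ⟩
    ΣS m (λ t → c zero * (Δ h ∣ t ∣ * P t))
      ≈⟨ Σˡ-*ˡ L (c zero) _ ⟩
    c zero * ΣS m (λ t → Δ h ∣ t ∣ * P t)
      ≈⟨ *-congˡ (ΣS-sign≈Δ^ m (λ i → c (suc i)) (Δ h)) ⟩
    c zero * (ΠFin m (λ i → c (suc i)) * Δ^ m (Δ h) 0)
      ≈⟨ sym (*-assoc _ _ _) ⟩
    ΠFin (suc m) c * Δ^ (suc m) h 0 ∎
    where
      L : List (Subset m)
      L = allSubsets m
      P : Subset m → Carrier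
      P t = ΠFin m (λ i → sign (lookup t i) (c (suc i)))
      collect : ∀ x y k p → x * (- k * p) + y * (k * p) ≈ k * ((y - x) * p)
      collect x y k p = begin
        x * (- k * p) + y * (k * p)    ≈⟨ +-congʳ (trans (*-congˡ (sym (-‿distribˡ-* k p)))
                                                   (trans (sym (-‿distribʳ-* x _)) (-‿distribˡ-* x _))) ⟩
        - x * (k * p) + y * (k * p)    ≈⟨ trans (sym (distribʳ _ _ _)) (*-congʳ (+-comm _ _)) ⟩
        (y - x) * (k * p)              ≈⟨ solve 3 (λ d k p → d :* (k :* p) := k :* (d :* p)) refl _ k p ⟩
        k * ((y - x) * p) ∎

  natF-+ : ∀ a b → natF (a ℕ.+ b) ≈ natF a + natF b
  natF-+ zero    b = sym (+-identityˡ _)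
  natF-+ (suc a) b = trans (+-congˡ (natF-+ a b)) (sym (+-assoc _ _ _))

  natF≉0-below-char : ∀ m → (Char0 ⊎ (∃ λ p → CharIs p × m < p)) →
                      ∀ k → 0 < k → k ≤ m → ¬ (natF k ≈ 0#)
  natF≉0-below-char m (inj₁ char0)                    k 0<k _   = char0 k 0<k
  natF≉0-below-char m (inj₂ (p , (_ , _ , below) , m<p)) k 0<k k≤m = below k 0<k (ℕₚ.≤-<-trans k≤m m<p)

  Σˡ-tabulate-count : ∀ {A : Set} m (f : Fin m → A) (v : Subset m) (h : A → Carrier) →
                      (∀ i → h (f i) ≈ fromBool (lookup v i)) → Σˡ (List.tabulate f) h ≈ natF ∣ v ∣
  Σˡ-tabulate-count zero    f []      h h≈v = refl
  Σˡ-tabulate-count (suc m) f (b ∷ v) h h≈v =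
    trans (+-cong (h≈v zero) (Σˡ-tabulate-count m (λ i → f (suc i)) v h (λ i → h≈v (suc i)))) (count-step b)
    where
      count-step : ∀ b → fromBool b + natF ∣ v ∣ ≈ natF ∣ b ∷ v ∣
      count-step inside  = refl
      count-step outside = +-identityˡ _

  -‿≉0 : ∀ {x} → ¬ (x ≈ 0#) → ¬ (- x ≈ 0#)
  -‿≉0 x≉0 -x≈0 = x≉0 (trans (sym (-‿involutive _)) (trans (-‿cong -x≈0) -0#≈0#))

  *-inverse-unique : ∀ {x y z} → x * y ≈ 1# → z * y ≈ 1# → x ≈ z
  *-inverse-unique {x} {y} {z} xy≈1 zy≈1 = begin
    x             ≈⟨ sym (*-identityʳ x) ⟩
    x * 1#        ≈⟨ *-congˡ (sym zy≈1) ⟩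
    x * (z * y)   ≈⟨ solve 3 (λ x y z → x :* (z :* y) := (x :* y) :* z) refl x y z ⟩
    (x * y) * z   ≈⟨ *-congʳ xy≈1 ⟩
    1# * z        ≈⟨ *-identityˡ z ⟩
    z ∎

  eval-of-inverse : ∀ {n} {f g : ML n} → (f ⊛ g) ≈ᴾ const 1# →
                    ∀ a {y} → y * eval g a ≈ 1# → eval f a ≈ y
  eval-of-inverse {f = f} {g} fg≈1 a yg≈1 =
    *-inverse-unique (trans (sym (eval-⊛ f g a)) (trans (eval-cong fg≈1 a) (eval-const 1# a))) yg≈1

  module _ (isField : IsField F) where
    open IsField isField

    *-≉0 : ∀ {x y} → ¬ (x ≈ 0#) → ¬ (y ≈ 0#) → ¬ (x * y ≈ 0#)
    *-≉0 {x} {y} x≉0 y≉0 xy≈0 with inverse x x≉0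
    ... | x⁻¹ , xx⁻¹≈1 = y≉0 (begin
      y              ≈⟨ sym (*-identityˡ y) ⟩
      1# * y         ≈⟨ *-congʳ (sym xx⁻¹≈1) ⟩
      (x * x⁻¹) * y  ≈⟨ solve 3 (λ x x' y → (x :* x') :* y := x' :* (x :* y)) refl x x⁻¹ y ⟩
      x⁻¹ * (x * y)  ≈⟨ *-congˡ xy≈0 ⟩
      x⁻¹ * 0#       ≈⟨ zeroʳ x⁻¹ ⟩
      0# ∎)

    ΠFin-≉0 : ∀ m (c : Fin m → Carrier) → (∀ i → ¬ (c i ≈ 0#)) → ¬ (ΠFin m c ≈ 0#)
    ΠFin-≉0 zero    c c≉0 = 1≉0
    ΠFin-≉0 (suc m) c c≉0 = *-≉0 (c≉0 zero) (ΠFin-≉0 m (λ i → c (suc i)) (λ i → c≉0 (suc i)))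

    inverses-upto : ∀ m (g : ℕ → Carrier) → (∀ k → k ≤ m → ¬ (g k ≈ 0#)) →
                    ∃ λ (w : ℕ → Carrier) → ∀ k → k ≤ m → w k * g k ≈ 1#
    inverses-upto m g g≉0 = w , w-inv
      where
        w : ℕ → Carrier
        w k with k ≤? m
        ... | yes k≤m = proj₁ (inverse (g k) (g≉0 k k≤m))
        ... | no  _   = 0#
        w-inv : ∀ k → k ≤ m → w k * g k ≈ 1#
        w-inv k k≤m with k ≤? m
        ... | yes k≤m′ = trans (*-comm _ _) (proj₂ (inverse (g k) (g≉0 k k≤m′)))
        ... | no  k≰m  = ⊥-elim (k≰m k≤m)

  module ReciprocalDifferences (isField : IsField F) (β : Carrier) (m : ℕ)
                               (β≉k : ∀ k → k ≤ m → ¬ (β ≈ natF k)) where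
    open Algebra.Properties.Group +-group using (x∙y⁻¹≈ε⇒x≈y)

    L : ℕ → Carrier
    L x = natF x - β

    L≉0 : ∀ k → k ≤ m → ¬ (L k ≈ 0#)
    L≉0 k k≤m k-β≈0 = β≉k k k≤m (sym (x∙y⁻¹≈ε⇒x≈y _ _ k-β≈0))

    w : ℕ → Carrier
    w = proj₁ (inverses-upto isField m L L≉0)

    w-inv : ∀ k → k ≤ m → w k * L k ≈ 1#
    w-inv = proj₂ (inverses-upto isField m L L≉0)

    rising : ℕ → ℕ → Carrier
    rising zero    x = L x
    rising (suc j) x = L x * rising j (suc x)

    rising-snoc : ∀ j x → rising (suc j) x ≈ rising j x * L (suc (j ℕ.+ x))
    rising-snoc zero    x = refl
    rising-snoc (suc j) x = trans (*-congˡ (rising-snoc j (suc x)))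
      (trans (sym (*-assoc _ _ _)) (*-congˡ (reflexive (≡.cong (λ z → L (suc z)) (ℕₚ.+-suc j x)))))

    signedFactorial : ℕ → Carrier
    signedFactorial zero    = 1#
    signedFactorial (suc j) = - (natF (suc j) * signedFactorial j)

    L-L : ∀ j x → L x - L (suc j ℕ.+ x) ≈ - natF (suc j)
    L-L j x = begin
      L x - L (suc j ℕ.+ x)         ≈⟨ +-congˡ (-‿cong (+-congʳ (natF-+ (suc j) x))) ⟩
      (a - β) - ((d + a) - β)       ≈⟨ +-congˡ (sym (-‿+-comm _ _)) ⟩
      (a - β) + (- (d + a) + - - β) ≈⟨ +-congˡ (+-cong (sym (-‿+-comm _ _)) (-‿involutive β)) ⟩
      (a - β) + ((- d + - a) + β)
        ≈⟨ solve 5 (λ a nb nd na b → (a :+ nb) :+ ((nd :+ na) :+ b) := nd :+ ((a :+ na) :+ (nb :+ b)))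
                   refl a (- β) (- d) (- a) β ⟩
      - d + ((a - a) + (- β + β))   ≈⟨ +-congˡ (+-cong (-‿inverseʳ a) (-‿inverseˡ β)) ⟩
      - d + (0# + 0#)               ≈⟨ trans (+-congˡ (+-identityˡ 0#)) (+-identityʳ _) ⟩
      - d ∎
      where
        a d : Carrier
        a = natF x
        d = natF (suc j)

    Δ^w*rising≈signedFactorial : ∀ j x → x ℕ.+ j ≤ m → Δ^ j w x * rising j x ≈ signedFactorial j
    Δ^w*rising≈signedFactorial zero    x x≤m = w-inv x (≡.subst (_≤ m) (ℕₚ.+-identityʳ x) x≤m)
    Δ^w*rising≈signedFactorial (suc j) x x+j<m = begin
      Δ^ (suc j) w x * rising (suc j) x
        ≡⟨ ≡.cong (_* rising (suc j) x) (Δ^-Δ j w x) ⟩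
      (Δ^ j w (suc x) - Δ^ j w x) * rising (suc j) x
        ≈⟨ distribʳ _ _ _ ⟩
      Δ^ j w (suc x) * (L x * rising j (suc x)) + (- Δ^ j w x) * rising (suc j) x
        ≈⟨ +-cong shifted (trans (sym (-‿distribˡ-* _ _)) (-‿cong unshifted)) ⟩
      L x * N + - (N * L (suc j ℕ.+ x))
        ≈⟨ trans (+-cong (*-comm _ _) (-‿distribʳ-* _ _)) (sym (distribˡ _ _ _)) ⟩
      N * (L x - L (suc j ℕ.+ x))
        ≈⟨ *-congˡ (L-L j x) ⟩
      N * - natF (suc j)
        ≈⟨ trans (sym (-‿distribʳ-* _ _)) (-‿cong (*-comm _ _)) ⟩
      signedFactorial (suc j) ∎
      where
        N : Carrier
        N = signedFactorial j
        shifted : Δ^ j w (suc x) * (L x * rising j (suc x)) ≈ L x * N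
        shifted = trans (solve 3 (λ a b c → a :* (b :* c) := b :* (a :* c)) refl _ _ _)
                        (*-congˡ (Δ^w*rising≈signedFactorial j (suc x) (≡.subst (_≤ m) (ℕₚ.+-suc x j) x+j<m)))
        unshifted : Δ^ j w x * rising (suc j) x ≈ N * L (suc j ℕ.+ x)
        unshifted = trans (*-congˡ (rising-snoc j x)) (trans (sym (*-assoc _ _ _))
          (*-congʳ (Δ^w*rising≈signedFactorial j x (ℕₚ.≤-trans (ℕₚ.+-monoʳ-≤ x (ℕₚ.n≤1+n j)) x+j<m))))

    module _ (natF≉0 : ∀ k → 0 < k → k ≤ m → ¬ (natF k ≈ 0#)) where
      open IsField isField using (1≉0)

      signedFactorial≉0 : ∀ j → j ≤ m → ¬ (signedFactorial j ≈ 0#)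
      signedFactorial≉0 zero    _   = 1≉0
      signedFactorial≉0 (suc j) j<m = -‿≉0 (*-≉0 isField (natF≉0 (suc j) (s≤s z≤n) j<m)
                                                    (signedFactorial≉0 j (ℕₚ.≤-trans (ℕₚ.n≤1+n j) j<m)))

      Δ^w≉0 : ¬ (Δ^ m w 0 ≈ 0#)
      Δ^w≉0 Δ^w≈0 = signedFactorial≉0 m ℕₚ.≤-refl
        (trans (sym (Δ^w*rising≈signedFactorial m 0 ℕₚ.≤-refl)) (trans (*-congʳ Δ^w≈0) (zeroˡ _)))

  eval-BlockLocal : ∀ {n m} {part : Fin n → Fin m} {ψ : Fin m → ML n} →
                    (∀ i → InVars (block part i) (ψ i)) → BlockLocal part (λ i → eval (ψ i))
  eval-BlockLocal ψ∈B i a b a∩B≡b∩B =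
    trans (eval-∩ (ψ∈B i) a) (trans (reflexive (≡.cong (eval _) a∩B≡b∩B)) (sym (eval-∩ (ψ∈B i) b)))

  alt-⊤-count : ∀ n m (part : Fin n → Fin m) → (∀ i → ∃ λ j → lookup (block part i) j ≡ inside) →
                (e : Fin m → Subset n → Carrier) → BlockLocal part e →
                (s : Subset n → Subset m) → (∀ a i → e i a ≈ fromBool (lookup (s a) i)) →
                (h : ℕ → Carrier) →
                alt ⊤ (λ a → h ∣ s a ∣) ≈ ΠFin m (λ i → alt (block part i) (e i)) * Δ^ m h 0
  alt-⊤-count n m part nonempty e local s e≈s h = begin
    alt ⊤ (λ a → h ∣ s a ∣)
      ≈⟨ alt-cong (⊤ {n}) (λ a → sym (ΣS-interpolate m (s a) (λ i → e i a) (e≈s a) (λ t → h ∣ t ∣))) ⟩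
    alt ⊤ (λ a → ΣS m (λ t → h ∣ t ∣ * ΠFin m (λ i → agree (lookup t i) (e i a))))
      ≈⟨ alt-Σˡ (⊤ {n}) (allSubsets m) _ ⟩
    ΣS m (λ t → alt ⊤ (λ a → h ∣ t ∣ * ΠFin m (λ i → agree (lookup t i) (e i a))))
      ≈⟨ Σˡ-cong (allSubsets m) (λ t → alt-*ˡ (⊤ {n}) (h ∣ t ∣) _) ⟩
    ΣS m (λ t → h ∣ t ∣ * alt ⊤ (λ a → ΠFin m (λ i → agree (lookup t i) (e i a))))
      ≈⟨ Σˡ-cong (allSubsets m) (λ t → *-congˡ (alt-⊤-ΠFin n m part _
                                    (λ i a b eq → agree-cong (lookup t i) (local i a b eq)))) ⟩
    ΣS m (λ t → h ∣ t ∣ * ΠFin m (λ i → alt (block part i) (λ a → agree (lookup t i) (e i a))))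
      ≈⟨ Σˡ-cong (allSubsets m) (λ t → *-congˡ (ΠFin-cong m (λ i →
           alt-agree (lookup t i) (block part i) (proj₂ (nonempty i)) (e i)))) ⟩
    ΣS m (λ t → h ∣ t ∣ * ΠFin m (λ i → sign (lookup t i) (alt (block part i) (e i))))
      ≈⟨ ΣS-sign≈Δ^ m _ h ⟩
    ΠFin m (λ i → alt (block part i) (e i)) * Δ^ m h 0 ∎

  coeff≉0-of-full-degree : ∀ {n} {B : Subset n} {f : ML n} → InVars B f → HasDegree f ∣ B ∣ → ¬ (f B ≈ 0#)
  coeff≉0-of-full-degree {B = B} {f} f∈B ((S , ∣S∣≡∣B∣ , fS≉0) , _) with S ⊆? B
  ... | no  S⊈B = ⊥-elim (fS≉0 (f∈B S S⊈B))
  ... | yes S⊆B = ≡.subst (λ X → ¬ (f X ≈ 0#)) (⊆∧∣≡∣⇒≡ S⊆B ∣S∣≡∣B∣) fS≉0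

  boolean-pattern : ∀ {n m} (B : Fin m → Subset n) (ψ : Fin m → ML n) →
                    (∀ i → InVars (B i) (ψ i)) → (∀ i → BooleanOn (B i) (ψ i)) →
                    ∃ λ (s : Subset n → Subset m) → ∀ a i → eval (ψ i) a ≈ fromBool (lookup (s a) i)
  boolean-pattern {n} {m} B ψ ψ∈B boolean = s , ψ≈s
    where
      value : ∀ i a → (eval (ψ i) (a ∩ B i) ≈ 0#) ⊎ (eval (ψ i) (a ∩ B i) ≈ 1#)
      value i a = boolean i (a ∩ B i) (p∩q⊆q a (B i))
      toBool : ∀ {x} → (x ≈ 0#) ⊎ (x ≈ 1#) → Bool
      toBool (inj₁ _) = false
      toBool (inj₂ _) = true
      toBool-correct : ∀ {x} (v : (x ≈ 0#) ⊎ (x ≈ 1#)) → x ≈ fromBool (toBool v)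
      toBool-correct (inj₁ x≈0) = x≈0
      toBool-correct (inj₂ x≈1) = x≈1
      s : Subset n → Subset m
      s a = tabulate (λ i → toBool (value i a))
      ψ≈s : ∀ a i → eval (ψ i) a ≈ fromBool (lookup (s a) i)
      ψ≈s a i = trans (eval-∩ (ψ∈B i) a) (trans (toBool-correct (value i a))
                      (reflexive (≡.cong fromBool (≡.sym (lookup∘tabulate _ i)))))

  eval-sumML-const : ∀ {n} m (ψ : Fin m → ML n) (s : Subset n → Subset m) →
                     (∀ a i → eval (ψ i) a ≈ fromBool (lookup (s a) i)) →
                     ∀ β a → eval (sumML m ψ ⊕ const (- β)) a ≈ natF ∣ s a ∣ - β
  eval-sumML-const m ψ s ψ≈s β a =
    trans (eval-⊕ (sumML m ψ) (const (- β)) a)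
          (+-cong (trans (eval-sumML m ψ a) (Σˡ-tabulate-count m (λ i → i) (s a) _ (ψ≈s a)))
                  (eval-const (- β) a))

lemma3p2 : ∀ {c ℓ} (F : CommutativeRing c ℓ) → IsField F →
    let open CommutativeRing F
        open Poly F
    in (n m : ℕ) (part : Fin n → Fin m) → Surjective _≡_ _≡_ part →
       (Char0 ⊎ (∃ λ p → CharIs p × m < p)) →
       (β : Carrier) → (∀ k → k ≤ m → ¬ (β ≈ natF k)) →
       (ψ : Fin m → ML n) →
       (∀ i → InVars (block part i) (ψ i)) →
       (∀ i → HasDegree (ψ i) ∣ block part i ∣) →
       (∀ i → BooleanOn (block part i) (ψ i)) →
       (f : ML n) →
       (f ⊛ (sumML m ψ ⊕ const (- β))) ≈ᴾ const 1# →
       HasDegree f n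
lemma3p2 F isField n m part surj char β β≉k ψ ψ∈B deg-ψ boolean-ψ f f-inverse =
  (⊤ , ∣⊤∣≡n n , f⊤≉0) , λ S _ → ∣p∣≤n S
  where
    open CommutativeRing F
    open Poly F
    open Multilinear F
    open import Relation.Binary.Reasoning.Setoid setoid

    s : Subset n → Subset m
    s = proj₁ (boolean-pattern (block part) ψ ψ∈B boolean-ψ)

    ψ≈s : ∀ a i → eval (ψ i) a ≈ fromBool (lookup (s a) i)
    ψ≈s = proj₂ (boolean-pattern (block part) ψ ψ∈B boolean-ψ)

    open ReciprocalDifferences isField β m β≉k

    f⊤≈ : f ⊤ ≈ ΠFin m (λ i → alt (block part i) (eval (ψ i))) * Δ^ m w 0
    f⊤≈ = begin
      f ⊤                      ≈⟨ coeff≈alt-eval ⊤ f (λ S S⊈⊤ → ⊥-elim (S⊈⊤ ⊆⊤)) ⟩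
      alt ⊤ (eval f)           ≈⟨ alt-cong (⊤ {n}) (λ a → eval-of-inverse f-inverse a
                                    (trans (*-congˡ (eval-sumML-const m ψ s ψ≈s β a))
                                           (w-inv ∣ s a ∣ (∣p∣≤n (s a))))) ⟩
      alt ⊤ (λ a → w ∣ s a ∣)  ≈⟨ alt-⊤-count n m part (block-member {part = part} surj)
                                    _ (eval-BlockLocal {part = part} ψ∈B) s ψ≈s w ⟩
      _ ∎

    f⊤≉0 : ¬ (f ⊤ ≈ 0#)
    f⊤≉0 f⊤≈0 = *-≉0 isField
      (ΠFin-≉0 isField m _ (λ i alt≈0 → coeff≉0-of-full-degree (ψ∈B i) (deg-ψ i)
                                          (trans (coeff≈alt-eval _ (ψ i) (ψ∈B i)) alt≈0)))
      (Δ^w≉0 (natF≉0-below-char m char))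
      (trans (sym f⊤≈) f⊤≈0)
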